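{- Let $n$ be a positive integer and let $t_m=\frac{m(m+1)}{2}$ for every non-negative integer $m$. Every integer $k$ with $0\le k\le t_{n-1}-1$ can be written uniquely as $k=t_r+s$ with $0\le s\le r\le n-2$; for such $k$ set $i_k=t_s$ and $j_k=t_{r+1}-t_s-1$. Let $$ M=\left(\binom{i_k}{\ell-j_k}\right)_{0\le k,\ell\le t_{n-1}-1}. $$ Then $M$ is block lower-triangular with respect to the partition of $\{0,1,\ldots,t_{n-1}-1\}$ (for both rows and columns) into the consecutive blocks $\{t_r,t_r+1,\ldots,t_r+r\}$, $r=0,1,\ldots,n-2$, of sizes $1,2,\ldots,n-1$: that is, for each $r\in\{0,\ldots,n-2\}$, the entries of $M$ in rows $k\in\{t_r,\ldots,t_r+r\}$ and columns $\ell\ge t_{r+1}$ are zero. Moreover, for each $r\in\{0,\ldots,n-2\}$, the diagonal block formed by rows $t_r+s$ and columns $t_r+m$ ($0\le s,m\le r$) equals $$ \left(\binom{t_s}{r-m}\right)_{0\le s,m\le r}, $$ i.e. the submatrix of the infinite binomial matrix $\left(\binom{i}{j}\right)_{(i,j)\in\mathbb{N}^2}$ with rows $t_0,t_1,\ldots,t_r$ and columns $r,r-1,\ldots,0$ (in that order).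
   Context: Binomial coefficients are extended by the convention $\binom{a}{b}=0$ whenever $b<0$ or $b>a$ (for non-negative integers $a$ and arbitrary integers $b$). -}

module Defs where

open import Data.Nat using (ℕ; zero; suc; _+_; _*_; _∸_; _≤_; _<_; _≤?_; _<?_)
open import Data.Nat.Combinatorics using (_C_)
open import Data.Integer as ℤ using (ℤ; +_; -[1+_])
open import Data.Product using (_×_; _,_; proj₁; proj₂)
open import Relation.Nullary using (yes; no)

t : ℕ → ℕ
t zero = 0
t (suc m) = t m + suc m

-- binomial coefficient with integer lower index: (a choose b) = 0 for b < 0
-- (and for b > a, which _C_ already does)
binomℤ : ℕ → ℤ → ℕ
binomℤ a (+ b) = a C b
binomℤ a -[1+ b ] = 0

-- decomposition of k as t r + s with s ≤ r, computed by searching rows: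
-- go r k : given that k is an offset from t r, find (r', s)
go : ℕ → ℕ → ℕ → ℕ × ℕ
go zero r k = (r , k)
go (suc fuel) r k with k ≤? r
... | yes _ = (r , k)
... | no _ = go fuel (suc r) (k ∸ suc r)

decomp : ℕ → ℕ × ℕ
decomp k = go k 0 k

iₖ : ℕ → ℕ
iₖ k = t (proj₂ (decomp k))

jₖ : ℕ → ℕ
jₖ k = t (suc (proj₁ (decomp k))) ∸ t (proj₂ (decomp k)) ∸ 1

M : ℕ → ℕ → ℕ
M k ℓ = binomℤ (iₖ k) (+ ℓ ℤ.- + jₖ k)

-- Row r of the triangle starts at t r and has r + 1 entries, so k = t r + s with s ≤ r
-- lies in row r, and the row search in decomp finds exactly this (r , s).  On that row
-- j_k + t s = t r + r, so the entry in column ℓ is binom(t s, t s + ℓ − (t r + r)).  For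
-- ℓ ≥ t (r + 1) the lower index exceeds t s, giving the zero blocks; for ℓ = t r + m it
-- is t s − (r − m), and the symmetry binom(a, a − d) = binom(a, d) (both sides vanish
-- when d > a) gives the diagonal block.
module Submission where

open import Defs
open import Data.Nat using (ℕ; zero; suc; _+_; _∸_; _≤_; _<_; z≤n; s≤s; s≤s⁻¹; _≤?_; _<?_)
open import Data.Nat.Properties
open import Data.Nat.Combinatorics using (_C_; nCk≡nC[n∸k]; k>n⇒nCk≡0)
open import Data.Integer as ℤ using (+_; -_; _⊖_)
open import Data.Integer.Properties using (m-n≡m⊖n; ⊖-≥; ⊖-<; +-cancelˡ-⊖)
open import Data.Product using (_×_; _,_; proj₁; proj₂; ∃₂)
open import Data.Sum using (inj₁; inj₂)
open import Relation.Binary.PropositionalEquality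
open import Relation.Nullary using (yes; no; contradiction)

t-mono : ∀ {s r} → s ≤ r → t s ≤ t r
t-mono {r = zero} z≤n = z≤n
t-mono {r = suc r} s≤1+r with m≤n⇒m<n∨m≡n s≤1+r
... | inj₂ refl = ≤-refl
... | inj₁ (s≤s s≤r) = ≤-trans (t-mono s≤r) (m≤m+n (t r) (suc r))

n≤t : ∀ n → n ≤ t n
n≤t zero = z≤n
n≤t (suc n) = subst (suc n ≤_) (+-comm (suc n) (t n)) (m≤m+n (suc n) (t n))

-- Δt a d = (a + 1) + ⋯ + (a + d) = t (a + d) − t a, the offset the row search skips.
Δt : ℕ → ℕ → ℕ
Δt a zero = 0
Δt a (suc d) = suc a + Δt (suc a) d

t+Δt : ∀ a d → t a + Δt a d ≡ t (a + d)
t+Δt a zero = trans (+-identityʳ (t a)) (cong t (sym (+-identityʳ a)))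
t+Δt a (suc d) = begin
  t a + (suc a + Δt (suc a) d) ≡⟨ +-assoc (t a) (suc a) _ ⟨
  t (suc a) + Δt (suc a) d     ≡⟨ t+Δt (suc a) d ⟩
  t (suc a + d)                ≡⟨ cong t (+-suc a d) ⟨
  t (a + suc d)                ∎
  where open ≡-Reasoning

go-Δt : ∀ fuel a d s → d ≤ fuel → s ≤ a + d → go fuel a (Δt a d + s) ≡ (a + d , s)
go-Δt zero a zero s _ _ = cong (_, s) (sym (+-identityʳ a))
go-Δt (suc fuel) a zero s _ s≤a+0 with s ≤? a
... | yes _ = cong (_, s) (sym (+-identityʳ a))
... | no s≰a = contradiction (subst (s ≤_) (+-identityʳ a) s≤a+0) s≰a
go-Δt (suc fuel) a (suc d) s (s≤s d≤fuel) s≤a+1+d with suc a + Δt (suc a) d + s ≤? a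
... | yes past-a = contradiction (≤-trans (s≤s (m≤m+n a _)) (subst (_≤ a) (+-assoc (suc a) _ s) past-a)) (n≮n a)
... | no _ = begin
  go fuel (suc a) (suc a + Δt (suc a) d + s ∸ suc a)
    ≡⟨ cong (go fuel (suc a)) (trans (cong (_∸ suc a) (+-assoc (suc a) _ s)) (m+n∸m≡n (suc a) _)) ⟩
  go fuel (suc a) (Δt (suc a) d + s)
    ≡⟨ go-Δt fuel (suc a) d s d≤fuel (subst (s ≤_) (+-suc a d) s≤a+1+d) ⟩
  (suc a + d , s)
    ≡⟨ cong (_, s) (+-suc a d) ⟨
  (a + suc d , s) ∎
  where open ≡-Reasoning

decomp-t+ : ∀ {r s} → s ≤ r → decomp (t r + s) ≡ (r , s)
decomp-t+ {r} {s} s≤r = begin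
  go (t r + s) 0 (t r + s)        ≡⟨ cong (λ x → go (t r + s) 0 (x + s)) (t+Δt 0 r) ⟨
  go (t r + s) 0 (Δt 0 r + s)     ≡⟨ go-Δt (t r + s) 0 r s (≤-trans (n≤t r) (m≤m+n (t r) s)) s≤r ⟩
  (r , s)                         ∎
  where open ≡-Reasoning

t+-unique : ∀ {r s r′ s′} → s ≤ r → s′ ≤ r′ → t r + s ≡ t r′ + s′ → (r , s) ≡ (r′ , s′)
t+-unique {r} {s} s≤r s′≤r′ eq =
  trans (sym (decomp-t+ s≤r)) (trans (cong decomp eq) (decomp-t+ s′≤r′))

below-t⇒t+ : ∀ m k → k < t m → ∃₂ λ r s → s ≤ r × r < m × k ≡ t r + s
below-t⇒t+ (suc m) k k<t[1+m] with k <? t m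
... | yes k<tm with below-t⇒t+ m k k<tm
...   | r , s , s≤r , r<m , k≡ = r , s , s≤r , m<n⇒m<1+n r<m , k≡
below-t⇒t+ (suc m) k k<t[1+m] | no k≮tm =
  m , k ∸ t m , s≤s⁻¹ (m<n+o⇒m∸n<o k (t m) k<t[1+m]) , ≤-refl , sym (m+[n∸m]≡n (≮⇒≥ k≮tm))

decomp-spec : ∀ m k → k < t m →
  let (r , s) = decomp k in k ≡ t r + s × s ≤ r × r < m
decomp-spec m k k<tm with below-t⇒t+ m k k<tm
... | r , s , s≤r , r<m , refl rewrite decomp-t+ s≤r = refl , s≤r , r<m

j+t≡t+r : ∀ {r s} → s ≤ r → t (suc r) ∸ t s ∸ 1 + t s ≡ t r + r
j+t≡t+r {r} {s} s≤r = begin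
  t (suc r) ∸ t s ∸ 1 + t s      ≡⟨ cong (_+ t s) (∸-+-assoc (t (suc r)) (t s) 1) ⟩
  t (suc r) ∸ (t s + 1) + t s    ≡⟨ cong (λ x → t (suc r) ∸ x + t s) (+-comm (t s) 1) ⟩
  t r + suc r ∸ suc (t s) + t s  ≡⟨ cong (λ x → x ∸ suc (t s) + t s) (+-suc (t r) r) ⟩
  t r + r ∸ t s + t s            ≡⟨ m∸n+n≡m (≤-trans (t-mono s≤r) (m≤m+n (t r) r)) ⟩
  t r + r                        ∎
  where open ≡-Reasoning

M-row : ∀ {r s} ℓ → s ≤ r → M (t r + s) ℓ ≡ binomℤ (t s) ((t s + ℓ) ⊖ (t r + r))
M-row {r} {s} ℓ s≤r = begin
  M (t r + s) ℓ                                       ≡⟨ cong entry (decomp-t+ s≤r) ⟩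
  binomℤ (t s) (+ ℓ ℤ.- + j)                          ≡⟨ cong (binomℤ (t s)) index ⟩
  binomℤ (t s) ((t s + ℓ) ⊖ (t r + r))                ∎
  where
  open ≡-Reasoning
  entry : ℕ × ℕ → ℕ
  entry (r′ , s′) = binomℤ (t s′) (+ ℓ ℤ.- + (t (suc r′) ∸ t s′ ∸ 1))
  j = t (suc r) ∸ t s ∸ 1
  index : + ℓ ℤ.- + j ≡ (t s + ℓ) ⊖ (t r + r)
  index = begin
    + ℓ ℤ.- + j              ≡⟨ m-n≡m⊖n ℓ j ⟩
    ℓ ⊖ j                    ≡⟨ +-cancelˡ-⊖ (t s) ℓ j ⟨
    (t s + ℓ) ⊖ (t s + j)    ≡⟨ cong ((t s + ℓ) ⊖_) (trans (+-comm (t s) j) (j+t≡t+r s≤r)) ⟩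
    (t s + ℓ) ⊖ (t r + r)    ∎

binomℤ-⊖-above : ∀ {a b c} → a + c < b → binomℤ a (b ⊖ c) ≡ 0
binomℤ-⊖-above {a} {b} {c} a+c<b = begin
  binomℤ a (b ⊖ c)     ≡⟨ cong (binomℤ a) (⊖-≥ (m+n≤o⇒n≤o a (<⇒≤ a+c<b))) ⟩
  a C (b ∸ c)          ≡⟨ k>n⇒nCk≡0 (m+n≤o⇒m≤o∸n (suc a) a+c<b) ⟩
  0                    ∎
  where open ≡-Reasoning

binomℤ-negative : ∀ a {x} → 0 < x → binomℤ a (- + x) ≡ 0
binomℤ-negative a {suc x} _ = refl

binomℤ-⊖-symm : ∀ a d → binomℤ a (a ⊖ d) ≡ a C d
binomℤ-⊖-symm a d with d ≤? a
... | yes d≤a = trans (cong (binomℤ a) (⊖-≥ d≤a)) (sym (nCk≡nC[n∸k] d≤a))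
... | no d≰a = begin
  binomℤ a (a ⊖ d)       ≡⟨ cong (binomℤ a) (⊖-< a<d) ⟩
  binomℤ a (- + (d ∸ a)) ≡⟨ binomℤ-negative a (m<n⇒0<n∸m a<d) ⟩
  0                      ≡⟨ k>n⇒nCk≡0 a<d ⟨
  a C d                  ∎
  where
  open ≡-Reasoning
  a<d = ≰⇒> d≰a

M-right-of-block : ∀ {r s ℓ} → s ≤ r → t (suc r) ≤ ℓ → M (t r + s) ℓ ≡ 0
M-right-of-block {r} {s} {ℓ} s≤r t[1+r]≤ℓ =
  trans (M-row ℓ s≤r) (binomℤ-⊖-above {t s} {t s + ℓ} (+-monoʳ-< (t s) t+r<ℓ))
  where
  t+r<ℓ : t r + r < ℓ
  t+r<ℓ = subst (_≤ ℓ) (+-suc (t r) r) t[1+r]≤ℓ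

M-diagonal-block : ∀ {r s m} → s ≤ r → m ≤ r → M (t r + s) (t r + m) ≡ t s C (r ∸ m)
M-diagonal-block {r} {s} {m} s≤r m≤r = begin
  M (t r + s) (t r + m)                          ≡⟨ M-row (t r + m) s≤r ⟩
  binomℤ (t s) ((t s + (t r + m)) ⊖ (t r + r))   ≡⟨ cong (binomℤ (t s)) index ⟩
  binomℤ (t s) (t s ⊖ (r ∸ m))                   ≡⟨ binomℤ-⊖-symm (t s) (r ∸ m) ⟩
  t s C (r ∸ m)                                  ∎
  where
  open ≡-Reasoning
  index : (t s + (t r + m)) ⊖ (t r + r) ≡ t s ⊖ (r ∸ m)
  index = begin
    (t s + (t r + m)) ⊖ (t r + r)    ≡⟨ cong (_⊖ (t r + r)) (x+[y+z]≡y+[z+x] (t s) (t r) m) ⟩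
    (t r + (m + t s)) ⊖ (t r + r)    ≡⟨ +-cancelˡ-⊖ (t r) (m + t s) r ⟩
    (m + t s) ⊖ r                    ≡⟨ cong ((m + t s) ⊖_) (m+[n∸m]≡n m≤r) ⟨
    (m + t s) ⊖ (m + (r ∸ m))        ≡⟨ +-cancelˡ-⊖ m (t s) (r ∸ m) ⟩
    t s ⊖ (r ∸ m)                    ∎
    where
    x+[y+z]≡y+[z+x] : ∀ x y z → x + (y + z) ≡ y + (z + x)
    x+[y+z]≡y+[z+x] x y z = trans (+-comm x (y + z)) (+-assoc y z x)

lemma2 : (n : ℕ) → 1 ≤ n →
    ((k : ℕ) → k < t (n ∸ 1) →
      (k ≡ t (proj₁ (decomp k)) + proj₂ (decomp k))
      × (proj₂ (decomp k) ≤ proj₁ (decomp k))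
      × (proj₁ (decomp k) + 2 ≤ n)
      × ((r s : ℕ) → s ≤ r → r + 2 ≤ n → k ≡ t r + s → (r , s) ≡ decomp k))
    ×
    ((r s ℓ : ℕ) → r + 2 ≤ n → s ≤ r → t (suc r) ≤ ℓ → ℓ < t (n ∸ 1) →
      M (t r + s) ℓ ≡ 0)
    ×
    ((r s m : ℕ) → r + 2 ≤ n → s ≤ r → m ≤ r →
      M (t r + s) (t r + m) ≡ t s C (r ∸ m))
lemma2 (suc n) _ =
    (λ k k<t →
      let (k≡ , s≤r , r<n) = decomp-spec n k k<t in
      k≡ , s≤r , subst (_≤ suc n) (+-comm 2 _) (s≤s r<n) ,
      λ r s s≤r′ _ k≡′ → t+-unique s≤r′ s≤r (trans (sym k≡′) k≡))
  , (λ _ _ _ _ s≤r t[1+r]≤ℓ _ → M-right-of-block s≤r t[1+r]≤ℓ)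
  , (λ _ _ _ _ s≤r m≤r → M-diagonal-block s≤r m≤r)
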